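{- Let $\mathcal{A}=\{a_1<\dots<a_l\}\,|\,\{b_1<\dots<b_m\}$ be a set partition of $[l+m]$ into two blocks, and let $1\le j\le\min(l,m)$ be such that the $j$-th arc of the first block and the $j$-th arc of the second block cross. Then $\{a_1,\dots,a_j\}\cup\{b_1,\dots,b_j\}=[2j]$.
   Context: Let $\mathbb{N}^*=\mathbb{N}\cup\{\infty\}$ with $\infty$ larger than all integers. For a set $A=\{a_1<\dots<a_l\}$, its $j$-th arc is $(a_j,a_{j+1})$ for $j<l$ and $(a_l,\infty)$ for $j=l$. Arcs $(a,b)$ and $(c,d)$ cross if $a<c<b<d$ or $c<a<d<b$. -}

module Defs where

open import Data.Nat using (ℕ; zero; suc; _+_; _*_; _≤_; _<_; _<ᵇ_)
open import Data.Bool using (if_then_else_)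
open import Data.Product using (_×_; ∃-syntax; _,_)
open import Data.Sum using (_⊎_)
open import Data.Unit using (⊤)
open import Data.Empty using (⊥)
open import Relation.Binary.PropositionalEquality using (_≡_; _≢_)

data ℕ* : Set where
  fin : ℕ → ℕ*
  ∞   : ℕ*

_<*_ : ℕ* → ℕ* → Set
fin x <* fin y = x < y
fin x <* ∞     = ⊤
∞     <* _     = ⊥

Arc : Set
Arc = ℕ* × ℕ*

Cross : Arc → Arc → Set
Cross (a , b) (c , d) =
  (a <* c × c <* b × b <* d) ⊎ (c <* a × a <* d × d <* b)

-- A finite set {a₁ < … < aₗ} is given by a sequence a : ℕ → ℕ,
-- 1-indexed: only the values a 1 , … , a l are meaningful.
arc : (l : ℕ) (a : ℕ → ℕ) (j : ℕ) → Arc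
arc l a j = fin (a j) , (if j <ᵇ l then fin (a (suc j)) else ∞)

StrictlyIncreasing : (l : ℕ) (a : ℕ → ℕ) → Set
StrictlyIncreasing l a = ∀ i → 1 ≤ i → i < l → a i < a (suc i)

_∈Seq_∣_ : ℕ → (ℕ → ℕ) → ℕ → Set
x ∈Seq a ∣ l = ∃[ i ] (1 ≤ i × i ≤ l × a i ≡ x)

IsTwoBlockPartition : (l m : ℕ) (a b : ℕ → ℕ) → Set
IsTwoBlockPartition l m a b =
  1 ≤ l × 1 ≤ m
  × StrictlyIncreasing l a
  × StrictlyIncreasing m b
  × (∀ i → 1 ≤ i → i ≤ l → 1 ≤ a i × a i ≤ l + m)
  × (∀ i → 1 ≤ i → i ≤ m → 1 ≤ b i × b i ≤ l + m)
  × (∀ i i' → 1 ≤ i → i ≤ l → 1 ≤ i' → i' ≤ m → a i ≢ b i')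
  × (∀ x → 1 ≤ x → x ≤ l + m → (x ∈Seq a ∣ l) ⊎ (x ∈Seq b ∣ m))

{-# OPTIONS --safe #-}
module Submission where

-- Count, for each t ≤ l + m, the terms of either block that are at most t: the two counts
-- p and q sum to t, because every number in [1, t] is hit by exactly one block.
-- If the j-th arcs cross, the inner endpoint t (b j, say) lies in the j-th arc of both
-- blocks, so p = q = j; hence t = 2j and {a 1 … a j} ∪ {b 1 … b j} = [1, t].

open import Defs
open import Data.Nat using (ℕ; zero; suc; _+_; _*_; _≤_; _<_; _⊓_; _<ᵇ_; z≤n; s≤s)
open import Data.Nat.Properties
open import Data.Bool using (true; false)
open import Data.Product using (_×_; _,_; ∃₂; proj₁; proj₂)
open import Data.Sum using (_⊎_; inj₁; inj₂; [_,_])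
open import Function.Bundles using (_⇔_; mk⇔; module Equivalence)
open import Relation.Binary using (tri<; tri≈; tri>)
open import Relation.Binary.PropositionalEquality using (_≡_; _≢_; refl; sym; trans; cong; cong₂; subst; module ≡-Reasoning)
open import Relation.Nullary using (contradiction; ¬_)

open Equivalence using (to; from)

private variable
  i j l m p q t : ℕ
  a b : ℕ → ℕ

module _ (increasing : StrictlyIncreasing l a) where

  strictlyIncreasing-< : ∀ {i k} → 1 ≤ i → i < k → k ≤ l → a i < a k
  strictlyIncreasing-< {i} {suc k} 1≤i i<1+k 1+k≤l with m≤n⇒m<n∨m≡n (≤-pred i<1+k)
  ... | inj₂ refl = increasing i 1≤i 1+k≤l
  ... | inj₁ i<k  = <-trans (strictlyIncreasing-< 1≤i i<k (<⇒≤ 1+k≤l))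
                            (increasing k (≤-trans 1≤i (<⇒≤ i<k)) 1+k≤l)

  strictlyIncreasing-injective : ∀ {i k} → 1 ≤ i → i ≤ l → 1 ≤ k → k ≤ l → a i ≡ a k → i ≡ k
  strictlyIncreasing-injective {i} {k} 1≤i i≤l 1≤k k≤l ai≡ak with <-cmp i k
  ... | tri< i<k _ _ = contradiction ai≡ak (<⇒≢ (strictlyIncreasing-< 1≤i i<k k≤l))
  ... | tri≈ _ i≡k _ = i≡k
  ... | tri> _ _ k<i = contradiction (sym ai≡ak) (<⇒≢ (strictlyIncreasing-< 1≤k k<i i≤l))

-- For increasing a, p is the number of terms among a 1 , … , a l that are at most t.
RankIs : (l : ℕ) (a : ℕ → ℕ) (t p : ℕ) → Set
RankIs l a t p = p ≤ l × (∀ k → 1 ≤ k → k ≤ l → a k ≤ t ⇔ k ≤ p)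

InArc : (l : ℕ) (a : ℕ → ℕ) (j t : ℕ) → Set
InArc l a j t = a j ≤ t × (j < l → t < a (suc j))

rankIs-zero : (∀ k → 1 ≤ k → k ≤ l → 1 ≤ a k) → RankIs l a 0 0
rankIs-zero positive = z≤n , λ k 1≤k k≤l →
  mk⇔ (λ ak≤0 → contradiction (≤-trans (positive k 1≤k k≤l) ak≤0) n≮0)
      (λ k≤0 → contradiction (≤-trans 1≤k k≤0) n≮0)

rankIs-suc-∉ : (∀ k → 1 ≤ k → k ≤ l → a k ≢ suc t) → RankIs l a t p → RankIs l a (suc t) p
rankIs-suc-∉ avoids (p≤l , rank) = p≤l , λ k 1≤k k≤l → mk⇔
  (λ ak≤1+t → to (rank k 1≤k k≤l) (≤-pred (≤∧≢⇒< ak≤1+t (avoids k 1≤k k≤l))))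
  (λ k≤p → m≤n⇒m≤1+n (from (rank k 1≤k k≤l) k≤p))

rankIs-suc-index : StrictlyIncreasing l a → 1 ≤ i → i ≤ l → a i ≡ suc t → RankIs l a t p →
                   i ≡ suc p
rankIs-suc-index {l} {a} {i} {t} {p} increasing 1≤i i≤l ai≡1+t (_ , rank) =
  ≤-antisym (≮⇒≥ 1+p≮i) (≰⇒> i≰p)
  where
  i≰p : ¬ i ≤ p
  i≰p i≤p = 1+n≰n (subst (_≤ t) ai≡1+t (from (rank i 1≤i i≤l) i≤p))
  1+p≮i : ¬ suc p < i
  1+p≮i 1+p<i = 1+n≰n (to (rank (suc p) (s≤s z≤n) (≤-trans (<⇒≤ 1+p<i) i≤l)) a[1+p]≤t)
    where
    a[1+p]≤t : a (suc p) ≤ t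
    a[1+p]≤t = ≤-pred (subst (a (suc p) <_) ai≡1+t (strictlyIncreasing-< increasing (s≤s z≤n) 1+p<i i≤l))

rankIs-suc-∈ : StrictlyIncreasing l a → 1 ≤ i → i ≤ l → a i ≡ suc t → RankIs l a t p →
               RankIs l a (suc t) (suc p)
rankIs-suc-∈ {l} {a} {i} {t} {p} increasing 1≤i i≤l ai≡1+t r@(_ , rank) =
  subst (_≤ l) i≡1+p i≤l , λ k 1≤k k≤l → mk⇔ (index≤ k 1≤k k≤l) (value≤ k 1≤k k≤l)
  where
  i≡1+p : i ≡ suc p
  i≡1+p = rankIs-suc-index increasing 1≤i i≤l ai≡1+t r
  index≤ : ∀ k → 1 ≤ k → k ≤ l → a k ≤ suc t → k ≤ suc p
  index≤ k 1≤k k≤l ak≤1+t with m≤n⇒m<n∨m≡n ak≤1+t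
  ... | inj₁ ak<1+t = m≤n⇒m≤1+n (to (rank k 1≤k k≤l) (≤-pred ak<1+t))
  ... | inj₂ ak≡1+t = ≤-reflexive (trans k≡i i≡1+p)
    where k≡i = strictlyIncreasing-injective increasing 1≤k k≤l 1≤i i≤l (trans ak≡1+t (sym ai≡1+t))
  value≤ : ∀ k → 1 ≤ k → k ≤ l → k ≤ suc p → a k ≤ suc t
  value≤ k 1≤k k≤l k≤1+p with m≤n⇒m<n∨m≡n k≤1+p
  ... | inj₁ k<1+p = m≤n⇒m≤1+n (from (rank k 1≤k k≤l) (≤-pred k<1+p))
  ... | inj₂ refl  = ≤-reflexive (trans (cong a (sym i≡1+p)) ai≡1+t)

rankIs-inArc : 1 ≤ j → j ≤ l → InArc l a j t → RankIs l a t p → p ≡ j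
rankIs-inArc {j} {l} {a} {t} {p} 1≤j j≤l (aj≤t , t<next) (p≤l , rank) =
  ≤-antisym (≮⇒≥ j≮p) (to (rank j 1≤j j≤l) aj≤t)
  where
  j≮p : ¬ j < p
  j≮p j<p = <⇒≱ (t<next j<l) (from (rank (suc j) (s≤s z≤n) j<l) j<p)
    where j<l = <-≤-trans j<p p≤l

rank-exists : IsTwoBlockPartition l m a b → ∀ t → t ≤ l + m →
              ∃₂ λ p q → p + q ≡ t × RankIs l a t p × RankIs m b t q
rank-exists {l} {m} {a} {b} (_ , _ , incA , incB , rangeA , rangeB , disjoint , cover) = go
  where
  go : ∀ t → t ≤ l + m → ∃₂ λ p q → p + q ≡ t × RankIs l a t p × RankIs m b t q
  go zero _ = 0 , 0 , refl
            , rankIs-zero (λ k 1≤k k≤l → proj₁ (rangeA k 1≤k k≤l))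
            , rankIs-zero (λ k 1≤k k≤m → proj₁ (rangeB k 1≤k k≤m))
  go (suc t) 1+t≤N with go t (<⇒≤ 1+t≤N) | cover (suc t) (s≤s z≤n) 1+t≤N
  ... | p , q , p+q≡t , rankA , rankB | inj₁ (i , 1≤i , i≤l , ai≡1+t) =
    suc p , q , cong suc p+q≡t
    , rankIs-suc-∈ incA 1≤i i≤l ai≡1+t rankA
    , rankIs-suc-∉ (λ k 1≤k k≤m bk≡1+t →
        disjoint i k 1≤i i≤l 1≤k k≤m (trans ai≡1+t (sym bk≡1+t))) rankB
  ... | p , q , p+q≡t , rankA , rankB | inj₂ (i , 1≤i , i≤m , bi≡1+t) =
    p , suc q , trans (+-suc p q) (cong suc p+q≡t)
    , rankIs-suc-∉ (λ k 1≤k k≤l ak≡1+t →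
        disjoint k i 1≤k k≤l 1≤i i≤m (trans ak≡1+t (sym bi≡1+t))) rankA
    , rankIs-suc-∈ incB 1≤i i≤m bi≡1+t rankB

rankIs-initialSegment : IsTwoBlockPartition l m a b → t ≤ l + m →
  RankIs l a t p → RankIs m b t q →
  ∀ x → (x ∈Seq a ∣ p ⊎ x ∈Seq b ∣ q) ⇔ (1 ≤ x × x ≤ t)
rankIs-initialSegment {l} {m} {a} {b} {t} {p} {q}
  (_ , _ , _ , _ , rangeA , rangeB , _ , cover) t≤N (p≤l , rankA) (q≤m , rankB) x =
  mk⇔ bounded covered
  where
  bounded : x ∈Seq a ∣ p ⊎ x ∈Seq b ∣ q → 1 ≤ x × x ≤ t
  bounded (inj₁ (i , 1≤i , i≤p , ai≡x)) = subst (λ y → 1 ≤ y × y ≤ t) ai≡x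
    (proj₁ (rangeA i 1≤i i≤l) , from (rankA i 1≤i i≤l) i≤p)
    where i≤l = ≤-trans i≤p p≤l
  bounded (inj₂ (i , 1≤i , i≤q , bi≡x)) = subst (λ y → 1 ≤ y × y ≤ t) bi≡x
    (proj₁ (rangeB i 1≤i i≤m) , from (rankB i 1≤i i≤m) i≤q)
    where i≤m = ≤-trans i≤q q≤m
  covered : 1 ≤ x × x ≤ t → x ∈Seq a ∣ p ⊎ x ∈Seq b ∣ q
  covered (1≤x , x≤t) with cover x 1≤x (≤-trans x≤t t≤N)
  ... | inj₁ (i , 1≤i , i≤l , ai≡x) =
    inj₁ (i , 1≤i , to (rankA i 1≤i i≤l) (subst (_≤ t) (sym ai≡x) x≤t) , ai≡x)
  ... | inj₂ (i , 1≤i , i≤m , bi≡x) =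
    inj₂ (i , 1≤i , to (rankB i 1≤i i≤m) (subst (_≤ t) (sym bi≡x) x≤t) , bi≡x)

inArcs⇒initialSegment : IsTwoBlockPartition l m a b → 1 ≤ j → j ≤ l → j ≤ m → t ≤ l + m →
  InArc l a j t → InArc m b j t →
  ∀ x → (x ∈Seq a ∣ j ⊎ x ∈Seq b ∣ j) ⇔ (1 ≤ x × x ≤ 2 * j)
inArcs⇒initialSegment {l} {m} {a} {b} {j} {t} P 1≤j j≤l j≤m t≤N t∈arcA t∈arcB x
  with rank-exists P t t≤N
... | p , q , p+q≡t , rankA , rankB =
  subst (λ s → _ ⇔ (1 ≤ x × x ≤ s)) t≡2j
    (rankIs-initialSegment P t≤N (subst (RankIs l a t) p≡j rankA)
                                 (subst (RankIs m b t) q≡j rankB) x)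
  where
  open ≡-Reasoning
  p≡j : p ≡ j
  p≡j = rankIs-inArc 1≤j j≤l t∈arcA rankA
  q≡j : q ≡ j
  q≡j = rankIs-inArc 1≤j j≤m t∈arcB rankB
  t≡2j : t ≡ 2 * j
  t≡2j = begin
    t           ≡⟨ sym p+q≡t ⟩
    p + q       ≡⟨ cong₂ _+_ p≡j q≡j ⟩
    j + j       ≡⟨ cong (j +_) (sym (+-identityʳ j)) ⟩
    2 * j       ∎

inArc-self : StrictlyIncreasing l a → 1 ≤ j → InArc l a j (a j)
inArc-self increasing 1≤j = ≤-refl , increasing _ 1≤j

<*-arcEnd : fin t <* proj₂ (arc l a j) → j < l → t < a (suc j)
<*-arcEnd {l = l} {j = j} t<end j<l with j <ᵇ l | <⇒<ᵇ j<l
... | true  | _  = t<end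
... | false | ()

crossing⇒inArc : Cross (arc l a j) (arc m b j) → InArc l a j (b j) ⊎ InArc m b j (a j)
crossing⇒inArc {l} {a} {j} {m} {b} (inj₁ (aj<bj , bj<endA , _)) =
  inj₁ (<⇒≤ aj<bj , <*-arcEnd {l = l} {a} {j} bj<endA)
crossing⇒inArc {l} {a} {j} {m} {b} (inj₂ (bj<aj , aj<endB , _)) =
  inj₂ (<⇒≤ bj<aj , <*-arcEnd {l = m} {b} {j} aj<endB)

lemma3p23 : (l m : ℕ) (a b : ℕ → ℕ) → IsTwoBlockPartition l m a b →
    (j : ℕ) → 1 ≤ j → j ≤ l ⊓ m →
    Cross (arc l a j) (arc m b j) →
    ∀ x → (x ∈Seq a ∣ j ⊎ x ∈Seq b ∣ j) ⇔ (1 ≤ x × x ≤ 2 * j)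
lemma3p23 l m a b P@(_ , _ , incA , incB , rangeA , rangeB , _) j 1≤j j≤l⊓m crossing =
  [ (λ bj∈arcA → inArcs⇒initialSegment P 1≤j j≤l j≤m (proj₂ (rangeB j 1≤j j≤m))
                   bj∈arcA (inArc-self incB 1≤j))
  , (λ aj∈arcB → inArcs⇒initialSegment P 1≤j j≤l j≤m (proj₂ (rangeA j 1≤j j≤l))
                   (inArc-self incA 1≤j) aj∈arcB)
  ] (crossing⇒inArc {l} {a} {j} {m} {b} crossing)
  where
  j≤l = ≤-trans j≤l⊓m (m⊓n≤m l m)
  j≤m = ≤-trans j≤l⊓m (m⊓n≤n l m)
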